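{- Let $W$ be a finite partially ordered set, let $\Delta$ be a simplicial complex with ground set $W$, let $M \subseteq \Delta$ be a set of faces, and let $f : M \to W$ be a function. Consider the conditions: (C1) For every $F \in M$ we have $F \cup \{f(F)\} \in M$ and $F \setminus \{f(F)\} \in M$, and $f(F \cup \{f(F)\}) = f(F \setminus \{f(F)\}) = f(F)$. (C2) For every $F \in M$ and every $G \in M$ with $G \subseteq F$, we have $f(F) \le f(G)$. Assume (C1) holds. Then: (a) The map $\mu : M \to M$ given by $\mu(F) = F \setminus \{f(F)\}$ if $f(F) \in F$, and $\mu(F) = F \cup \{f(F)\}$ if $f(F) \notin F$, is well-defined, and $(M,\mu)$ is a matching on $\Delta$. (b) If (C2) also holds, then the matching $(M,\mu)$ is acyclic.
   Context: A simplicial complex with ground set $W$ (a finite set) is a set $\Delta$ of subsets of $W$ closed under taking subsets; its elements are faces. For faces $A,B$, write $A \prec B$ (equivalently $B \succ A$) if $A \subseteq B$ and $|B \setminus A| = 1$. A (partial) matching on $\Delta$ is a pair $(M,\mu)$ where $M \subseteq \Delta$ and $\mu : M \to M$ is an involution ($\mu\circ\mu = \mathrm{id}$) such that every $F \in M$ satisfies either $\mu(F) \prec F$ or $\mu(F) \succ F$. A cycle of $\mu$ is an $n$-tuple $(F_1,\dots,F_n)$ of distinct faces in $M$ with $n \ge 2$ such that $F_i \succ \mu(F_i) \prec F_{i+1}$ for each $i \in \{1,\dots,n\}$, where $F_{n+1} := F_1$. The matching is acyclic if it has no cycle. -}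

module Defs where

open import Level using (Level)
open import Data.Bool using (Bool; T; if_then_else_)
open import Data.Nat using (ℕ; suc; _≤_)
open import Data.Nat.DivMod using (_mod_)
open import Data.Fin using (Fin; toℕ)
open import Data.Fin.Subset using (Subset; _⊆_; _∪_; _─_; _-_; ⁅_⁆; ∣_∣; _∈_)
open import Data.Fin.Subset.Properties using (_∈?_)
open import Data.Product using (Σ; _×_)
open import Data.Sum using (_⊎_)
open import Relation.Nullary using (¬_; does)
open import Relation.Binary.PropositionalEquality using (_≡_)
open import Function.Definitions using (Injective)

IsSimplicialComplex : ∀ {n} → (Subset n → Set) → Set
IsSimplicialComplex {n} Δ = ∀ (F G : Subset n) → G ⊆ F → Δ F → Δ G

_≺_ : ∀ {n} → Subset n → Subset n → Set
A ≺ B = A ⊆ B × ∣ B ─ A ∣ ≡ 1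

-- A set of faces M is given by its (decidable) characteristic function.
-- A partial map μ : M → M is a function on faces in M.
PMap : ∀ {n} → (Subset n → Bool) → Set
PMap {n} M = (F : Subset n) → T (M F) → Subset n

record IsMatching {n} (Δ : Subset n → Set) (M : Subset n → Bool) (μ : PMap M) : Set where
  field
    M⊆Δ     : ∀ F → T (M F) → Δ F
    μ-in-M  : ∀ F (p : T (M F)) → T (M (μ F p))
    μ-invol : ∀ F (p : T (M F)) (q : T (M (μ F p))) → μ (μ F p) q ≡ F
    μ-cover : ∀ F (p : T (M F)) → (μ F p ≺ F) ⊎ (F ≺ μ F p)

next : ∀ {m} → Fin (suc m) → Fin (suc m)
next {m} i = suc (toℕ i) mod (suc m)

IsCycle : ∀ {n} (M : Subset n → Bool) (μ : PMap M) (m : ℕ)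
          (F : Fin (suc m) → Subset n) (inM : ∀ i → T (M (F i))) → Set
IsCycle M μ m F inM =
  2 ≤ suc m × Injective _≡_ _≡_ F ×
  (∀ i → (μ (F i) (inM i) ≺ F i) × (μ (F i) (inM i) ≺ F (next i)))

IsAcyclic : ∀ {n} (M : Subset n → Bool) (μ : PMap M) → Set
IsAcyclic {n} M μ =
  ∀ (m : ℕ) (F : Fin (suc m) → Subset n) (inM : ∀ i → T (M (F i))) → ¬ IsCycle M μ m F inM

μ-of : ∀ {n} (M : Subset n → Bool) (f : (F : Subset n) → T (M F) → Fin n) → PMap M
μ-of M f F p = if does (f F p ∈? F) then F - f F p else F ∪ ⁅ f F p ⁆

C1 : ∀ {n} (M : Subset n → Bool) (f : (F : Subset n) → T (M F) → Fin n) → Set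
C1 {n} M f = ∀ (F : Subset n) (p : T (M F)) →
  Σ (T (M (F ∪ ⁅ f F p ⁆))) λ q → Σ (T (M (F - f F p))) λ r →
    (f (F ∪ ⁅ f F p ⁆) q ≡ f F p) × (f (F - f F p) r ≡ f F p)

C2 : ∀ {n ℓ} (_≤W_ : Fin n → Fin n → Set ℓ) (M : Subset n → Bool)
     (f : (F : Subset n) → T (M F) → Fin n) → Set ℓ
C2 {n} _≤W_ M f = ∀ (F G : Subset n) (p : T (M F)) (q : T (M G)) → G ⊆ F → f F p ≤W f G q

-- μ toggles the label f F in F. By (C1) the toggled face is again in M and has
-- the same label, so toggling twice gives back F. In a cycle, F_i ≻ F_i - x_i ≺
-- F_{i+1} with x_i = f F_i, and (C2) applied to F_i - x_i ⊆ F_{i+1} makes the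
-- labels descend around the cycle; by antisymmetry they are all equal. Then
-- F_{i+1} contains both x_i and F_i - x_i and has one element more than the
-- latter, so F_{i+1} = F_i, contradicting distinctness.
module Submission where

open import Defs
open import Level using (Level)
open import Data.Nat using (ℕ; suc; zero; s≤s; z≤n; _<_)
open import Data.Nat.DivMod using (_%_; m<n⇒m%n≡m; n%n≡0)
open import Data.Bool using (Bool; T; if_then_else_)
open import Data.Bool.Properties using (T-irrelevant)
open import Data.Fin using (Fin; zero; suc; toℕ; inject₁; fromℕ; _≤_)
open import Data.Fin.Properties
  using (_≟_; toℕ-injective; toℕ-fromℕ<; toℕ-inject₁; toℕ<n; toℕ-fromℕ; ≤fromℕ)
open import Data.Fin.Induction using (<-weakInduction-startingFrom)
open import Data.Fin.Subset
  using (Subset; _⊆_; _∪_; _─_; _-_; ⁅_⁆; ∣_∣; _∈_; _∉_; ⊥; inside; outside)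
open import Data.Fin.Subset.Properties
  using (_∈?_; x∈⁅x⁆; x∈⁅y⁆⇒x≡y; ∣⁅x⁆∣≡1; ⊆-antisym; p⊆p∪q; x∈p∪q⁺; x∈p∪q⁻;
         ∪-identityʳ; p─⊥≡p; x∈p∧x∉q⇒x∈p─q; x∈p∧x≢y⇒x∈p-y; x∈p⇒∣p-x∣<∣p∣)
import Data.Nat.Properties as ℕ
open import Data.Vec using ([]; _∷_; here; there)
open import Data.Product using (_×_; _,_; proj₁; proj₂)
open import Data.Sum using (_⊎_; inj₁; inj₂; [_,_])
open import Function using (_∘_)
open import Relation.Binary.Core using (Rel)
open import Relation.Binary.Structures using (IsPreorder; IsPartialOrder)
open import Relation.Binary.PropositionalEquality
  using (_≡_; refl; sym; trans; cong; subst; module ≡-Reasoning)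
open import Relation.Nullary using (yes; no; contradiction)
open import Relation.Nullary.Decidable using (dec-true; dec-false)

private
  variable
    n m : ℕ
    x y : Fin n
    p q : Subset n

x∈p─q⇒x∉q : x ∈ p ─ q → x ∉ q
x∈p─q⇒x∉q {p = inside ∷ _} {outside ∷ _} here ()
x∈p─q⇒x∉q {p = _ ∷ _} {_ ∷ _} (there x∈p─q) (there x∈q) = x∈p─q⇒x∉q x∈p─q x∈q

x∉p-x : ∀ (x : Fin n) (p : Subset n) → x ∉ p - x
x∉p-x x p x∈p-x = x∈p─q⇒x∉q x∈p-x (x∈⁅x⁆ x)

p─p≡⊥ : ∀ (p : Subset n) → p ─ p ≡ ⊥
p─p≡⊥ []            = refl
p─p≡⊥ (inside  ∷ p) = cong (outside ∷_) (p─p≡⊥ p)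
p─p≡⊥ (outside ∷ p) = cong (outside ∷_) (p─p≡⊥ p)

p-x∪⁅x⁆≡p : x ∈ p → (p - x) ∪ ⁅ x ⁆ ≡ p
p-x∪⁅x⁆≡p {p = inside  ∷ p} here        = cong (inside ∷_) (trans (∪-identityʳ (p ─ ⊥)) (p─⊥≡p p))
p-x∪⁅x⁆≡p {p = inside  ∷ p} (there x∈p) = cong (inside ∷_) (p-x∪⁅x⁆≡p x∈p)
p-x∪⁅x⁆≡p {p = outside ∷ p} (there x∈p) = cong (outside ∷_) (p-x∪⁅x⁆≡p x∈p)

p∪⁅x⁆-x≡p : x ∉ p → (p ∪ ⁅ x ⁆) - x ≡ p
p∪⁅x⁆-x≡p {x = zero}  {inside  ∷ p} x∉p = contradiction here x∉p
p∪⁅x⁆-x≡p {x = zero}  {outside ∷ p} _   = cong (outside ∷_) (trans (p─⊥≡p (p ∪ ⊥)) (∪-identityʳ p))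
p∪⁅x⁆-x≡p {x = suc x} {inside  ∷ p} x∉p = cong (inside ∷_) (p∪⁅x⁆-x≡p (x∉p ∘ there))
p∪⁅x⁆-x≡p {x = suc x} {outside ∷ p} x∉p = cong (outside ∷_) (p∪⁅x⁆-x≡p (x∉p ∘ there))

p∪⁅x⁆─p≡⁅x⁆ : x ∉ p → (p ∪ ⁅ x ⁆) ─ p ≡ ⁅ x ⁆
p∪⁅x⁆─p≡⁅x⁆ {x = zero}  {inside  ∷ p} x∉p = contradiction here x∉p
p∪⁅x⁆─p≡⁅x⁆ {x = zero}  {outside ∷ p} _   = cong (inside ∷_) (trans (cong (_─ p) (∪-identityʳ p)) (p─p≡⊥ p))
p∪⁅x⁆─p≡⁅x⁆ {x = suc x} {inside  ∷ p} x∉p = cong (outside ∷_) (p∪⁅x⁆─p≡⁅x⁆ (x∉p ∘ there))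
p∪⁅x⁆─p≡⁅x⁆ {x = suc x} {outside ∷ p} x∉p = cong (outside ∷_) (p∪⁅x⁆─p≡⁅x⁆ (x∉p ∘ there))

p≺p∪⁅x⁆ : x ∉ p → p ≺ (p ∪ ⁅ x ⁆)
p≺p∪⁅x⁆ {x = x} x∉p = p⊆p∪q ⁅ x ⁆ , trans (cong ∣_∣ (p∪⁅x⁆─p≡⁅x⁆ x∉p)) (∣⁅x⁆∣≡1 x)

p-x≺p : x ∈ p → (p - x) ≺ p
p-x≺p {x = x} {p} x∈p = subst ((p - x) ≺_) (p-x∪⁅x⁆≡p x∈p) (p≺p∪⁅x⁆ (x∉p-x x p))

∣p∣≡1∧x∈p∧y∈p⇒x≡y : ∣ p ∣ ≡ 1 → x ∈ p → y ∈ p → x ≡ y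
∣p∣≡1∧x∈p∧y∈p⇒x≡y {p = p} {x} {y} ∣p∣≡1 x∈p y∈p with x ≟ y
... | yes x≡y = x≡y
... | no  x≢y = contradiction ∣p∣≡1 (ℕ.>⇒≢ (ℕ.≤-trans (s≤s 0<∣p-y∣) (x∈p⇒∣p-x∣<∣p∣ y∈p)))
  where
  0<∣p-y∣ : 0 < ∣ p - y ∣
  0<∣p-y∣ = ℕ.≤-<-trans z≤n (x∈p⇒∣p-x∣<∣p∣ (x∈p∧x≢y⇒x∈p-y x∈p x≢y))

p≺q∧x∈q─p⇒q≡p∪⁅x⁆ : p ≺ q → x ∈ q → x ∉ p → q ≡ p ∪ ⁅ x ⁆
p≺q∧x∈q─p⇒q≡p∪⁅x⁆ {p = p} {q} {x} (p⊆q , ∣q─p∣≡1) x∈q x∉p = ⊆-antisym q⊆p∪⁅x⁆ p∪⁅x⁆⊆q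
  where
  q⊆p∪⁅x⁆ : q ⊆ p ∪ ⁅ x ⁆
  q⊆p∪⁅x⁆ {z} z∈q with z ∈? p
  ... | yes z∈p = x∈p∪q⁺ (inj₁ z∈p)
  ... | no  z∉p = x∈p∪q⁺ (inj₂ (subst (_∈ ⁅ x ⁆) (sym z≡x) (x∈⁅x⁆ x)))
    where
    z≡x : z ≡ x
    z≡x = ∣p∣≡1∧x∈p∧y∈p⇒x≡y ∣q─p∣≡1 (x∈p∧x∉q⇒x∈p─q z∈q z∉p) (x∈p∧x∉q⇒x∈p─q x∈q x∉p)
  p∪⁅x⁆⊆q : p ∪ ⁅ x ⁆ ⊆ q
  p∪⁅x⁆⊆q z∈ = [ p⊆q , (λ z∈⁅x⁆ → subst (_∈ q) (sym (x∈⁅y⁆⇒x≡y x z∈⁅x⁆)) x∈q) ] (x∈p∪q⁻ p ⁅ x ⁆ z∈)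

toℕ-next : (i : Fin (suc m)) → toℕ (next i) ≡ suc (toℕ i) % suc m
toℕ-next i = toℕ-fromℕ< _

next-inject₁ : (i : Fin m) → next (inject₁ i) ≡ suc i
next-inject₁ {m} i = toℕ-injective (begin
  toℕ (next (inject₁ i))          ≡⟨ toℕ-next (inject₁ i) ⟩
  suc (toℕ (inject₁ i)) % suc m   ≡⟨ cong (λ k → suc k % suc m) (toℕ-inject₁ i) ⟩
  suc (toℕ i) % suc m             ≡⟨ m<n⇒m%n≡m (s≤s (toℕ<n i)) ⟩
  suc (toℕ i)                     ∎)
  where open ≡-Reasoning

next-fromℕ : next (fromℕ m) ≡ zero
next-fromℕ {m} = toℕ-injective (begin
  toℕ (next (fromℕ m))          ≡⟨ toℕ-next (fromℕ m) ⟩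
  suc (toℕ (fromℕ m)) % suc m   ≡⟨ cong (λ k → suc k % suc m) (toℕ-fromℕ m) ⟩
  suc m % suc m                 ≡⟨ n%n≡0 (suc m) ⟩
  0                             ∎)
  where open ≡-Reasoning

module _ {a ℓ₁ ℓ₂} {A : Set a} {_≈_ : Rel A ℓ₁} {_≲_ : Rel A ℓ₂} where

  descending-cycle-≲-earlier : IsPreorder _≈_ _≲_ → (x : Fin (suc m) → A) →
    (∀ i → x (next i) ≲ x i) → ∀ {i j} → i ≤ j → x j ≲ x i
  descending-cycle-≲-earlier isPreorder x descending {i} =
    <-weakInduction-startingFrom (λ j → x j ≲ x i) ≲-refl step
    where
    open IsPreorder isPreorder using () renaming (refl to ≲-refl; trans to ≲-trans)
    step : ∀ j → x (inject₁ j) ≲ x i → x (suc j) ≲ x i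
    step j = ≲-trans (subst (λ k → x k ≲ x (inject₁ j)) (next-inject₁ j) (descending (inject₁ j)))

  descending-cycle-constant : IsPartialOrder _≈_ _≲_ → (x : Fin (suc m) → A) →
    (∀ i → x (next i) ≲ x i) → ∀ i → x (next i) ≈ x i
  descending-cycle-constant {m} isPartialOrder x descending i =
    antisym (descending i) (≲-trans (≲-earlier z≤n) (≲-trans x₀≲xₘ (≲-earlier (≤fromℕ (next i)))))
    where
    open IsPartialOrder isPartialOrder using (antisym; isPreorder) renaming (trans to ≲-trans)
    ≲-earlier : ∀ {i j} → i ≤ j → x j ≲ x i
    ≲-earlier = descending-cycle-≲-earlier isPreorder x descending
    x₀≲xₘ : x zero ≲ x (fromℕ m)
    x₀≲xₘ = subst (λ k → x k ≲ x (fromℕ m)) next-fromℕ (descending (fromℕ m))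

module _ (M : Subset n → Bool) (f : (F : Subset n) → T (M F) → Fin n) where

  μ-of-∈ : ∀ F p → f F p ∈ F → μ-of M f F p ≡ F - f F p
  μ-of-∈ F p x∈F = cong (if_then F - f F p else F ∪ ⁅ f F p ⁆) (dec-true (f F p ∈? F) x∈F)

  μ-of-∉ : ∀ F p → f F p ∉ F → μ-of M f F p ≡ F ∪ ⁅ f F p ⁆
  μ-of-∉ F p x∉F = cong (if_then F - f F p else F ∪ ⁅ f F p ⁆) (dec-false (f F p ∈? F) x∉F)

  μ-of-≺⇒∈ : ∀ F p → μ-of M f F p ≺ F → f F p ∈ F
  μ-of-≺⇒∈ F p (μF⊆F , _) with f F p ∈? F
  ... | yes x∈F = x∈F
  ... | no  x∉F = μF⊆F (x∈p∪q⁺ (inj₂ (x∈⁅x⁆ (f F p))))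

module InducedMatching (M : Subset n → Bool) (f : (F : Subset n) → T (M F) → Fin n)
                       (c1 : C1 M f) where

  μ : PMap M
  μ = μ-of M f

  f-cong : ∀ {G H} → G ≡ H → (p : T (M G)) (q : T (M H)) → f G p ≡ f H q
  f-cong {G} refl p q = cong (f G) (T-irrelevant p q)

  F∪⁅f⁆∈M : ∀ F p → T (M (F ∪ ⁅ f F p ⁆))
  F∪⁅f⁆∈M F p = proj₁ (c1 F p)

  F-f∈M : ∀ F p → T (M (F - f F p))
  F-f∈M F p = proj₁ (proj₂ (c1 F p))

  f[F∪⁅f⁆]≡f : ∀ F p q → f (F ∪ ⁅ f F p ⁆) q ≡ f F p
  f[F∪⁅f⁆]≡f F p q = trans (f-cong refl q (F∪⁅f⁆∈M F p)) (proj₁ (proj₂ (proj₂ (c1 F p))))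

  f[F-f]≡f : ∀ F p q → f (F - f F p) q ≡ f F p
  f[F-f]≡f F p q = trans (f-cong refl q (F-f∈M F p)) (proj₂ (proj₂ (proj₂ (c1 F p))))

  μ-in-M : ∀ F (p : T (M F)) → T (M (μ F p))
  μ-in-M F p with f F p ∈? F
  ... | yes _ = F-f∈M F p
  ... | no  _ = F∪⁅f⁆∈M F p

  f∘μ≡f : ∀ F p (q : T (M (μ F p))) → f (μ F p) q ≡ f F p
  f∘μ≡f F p q with f F p ∈? F
  ... | yes _ = f[F-f]≡f F p q
  ... | no  _ = f[F∪⁅f⁆]≡f F p q

  μ-invol : ∀ F (p : T (M F)) (q : T (M (μ F p))) → μ (μ F p) q ≡ F
  μ-invol F p q with f F p ∈? F
  ... | yes a∈F = begin
    μ (F - a) q               ≡⟨ μ-of-∉ M f (F - a) q (subst (_∉ F - a) (sym fμF≡a) (x∉p-x a F)) ⟩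
    (F - a) ∪ ⁅ f (F - a) q ⁆ ≡⟨ cong (λ b → (F - a) ∪ ⁅ b ⁆) fμF≡a ⟩
    (F - a) ∪ ⁅ a ⁆           ≡⟨ p-x∪⁅x⁆≡p a∈F ⟩
    F                         ∎
    where
    open ≡-Reasoning
    a : Fin n
    a = f F p
    fμF≡a : f (F - a) q ≡ a
    fμF≡a = f[F-f]≡f F p q
  ... | no  a∉F = begin
    μ (F ∪ ⁅ a ⁆) q               ≡⟨ μ-of-∈ M f (F ∪ ⁅ a ⁆) q a∈μF ⟩
    (F ∪ ⁅ a ⁆) - f (F ∪ ⁅ a ⁆) q ≡⟨ cong ((F ∪ ⁅ a ⁆) -_) fμF≡a ⟩
    (F ∪ ⁅ a ⁆) - a               ≡⟨ p∪⁅x⁆-x≡p a∉F ⟩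
    F                             ∎
    where
    open ≡-Reasoning
    a : Fin n
    a = f F p
    fμF≡a : f (F ∪ ⁅ a ⁆) q ≡ a
    fμF≡a = f[F∪⁅f⁆]≡f F p q
    a∈μF : f (F ∪ ⁅ a ⁆) q ∈ F ∪ ⁅ a ⁆
    a∈μF = subst (_∈ F ∪ ⁅ a ⁆) (sym fμF≡a) (x∈p∪q⁺ (inj₂ (x∈⁅x⁆ a)))

  μ-cover : ∀ F (p : T (M F)) → (μ F p ≺ F) ⊎ (F ≺ μ F p)
  μ-cover F p with f F p ∈? F
  ... | yes x∈F = inj₁ (p-x≺p x∈F)
  ... | no  x∉F = inj₂ (p≺p∪⁅x⁆ x∉F)

  isMatching : (Δ : Subset n → Set) → (∀ F → T (M F) → Δ F) → IsMatching Δ M μ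
  isMatching Δ M⊆Δ = record { M⊆Δ = M⊆Δ ; μ-in-M = μ-in-M ; μ-invol = μ-invol ; μ-cover = μ-cover }

  step-with-equal-labels⇒≡ : ∀ F G p q → μ F p ≺ F → μ F p ≺ G → μ G q ≺ G →
                             f G q ≡ f F p → G ≡ F
  step-with-equal-labels⇒≡ F G p q μF≺F μF≺G μG≺G fG≡fF = begin
    G                ≡⟨ p≺q∧x∈q─p⇒q≡p∪⁅x⁆ F-a≺G a∈G (x∉p-x a F) ⟩
    (F - a) ∪ ⁅ a ⁆  ≡⟨ p-x∪⁅x⁆≡p a∈F ⟩
    F                ∎
    where
    open ≡-Reasoning
    a : Fin n
    a = f F p
    a∈F : a ∈ F
    a∈F = μ-of-≺⇒∈ M f F p μF≺F
    a∈G : a ∈ G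
    a∈G = subst (_∈ G) fG≡fF (μ-of-≺⇒∈ M f G q μG≺G)
    F-a≺G : (F - a) ≺ G
    F-a≺G = subst (_≺ G) (μ-of-∈ M f F p a∈F) μF≺G

  module _ {ℓ} {_≤W_ : Fin n → Fin n → Set ℓ} (≤W-isPartialOrder : IsPartialOrder _≡_ _≤W_)
           (c2 : C2 _≤W_ M f) where

    f-descends : ∀ F G p q → μ F p ⊆ G → f G q ≤W f F p
    f-descends F G p q μF⊆G = subst (f G q ≤W_) (f∘μ≡f F p μF∈M) (c2 G (μ F p) q μF∈M μF⊆G)
      where
      μF∈M : T (M (μ F p))
      μF∈M = μ-in-M F p

    μ-acyclic : IsAcyclic M μ
    μ-acyclic zero    F inM (s≤s () , _)
    μ-acyclic (suc m) F inM (_ , F-injective , steps) =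
      contradiction (trans (sym next-fromℕ) (F-injective (F-next≡F (fromℕ (suc m))))) λ ()
      where
      a : Fin (suc (suc m)) → Fin n
      a i = f (F i) (inM i)

      a-constant : ∀ i → a (next i) ≡ a i
      a-constant = descending-cycle-constant ≤W-isPartialOrder a λ i →
        f-descends (F i) (F (next i)) (inM i) (inM (next i)) (proj₁ (proj₂ (steps i)))

      F-next≡F : ∀ i → F (next i) ≡ F i
      F-next≡F i = step-with-equal-labels⇒≡ (F i) (F (next i)) (inM i) (inM (next i))
        (proj₁ (steps i)) (proj₂ (steps i)) (proj₁ (steps (next i))) (a-constant i)

lemma4p10 : ∀ {ℓ : Level} (n : ℕ) (_≤W_ : Fin n → Fin n → Set ℓ)
    → IsPartialOrder _≡_ _≤W_
    → (Δ : Subset n → Set) → IsSimplicialComplex Δ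
    → (M : Subset n → Bool) → (∀ F → T (M F) → Δ F)
    → (f : (F : Subset n) → T (M F) → Fin n)
    → C1 M f
    → IsMatching Δ M (μ-of M f) × (C2 _≤W_ M f → IsAcyclic M (μ-of M f))
lemma4p10 n _≤W_ ≤W-isPartialOrder Δ _ M M⊆Δ f c1 =
  isMatching Δ M⊆Δ , μ-acyclic ≤W-isPartialOrder
  where open InducedMatching M f c1
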